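{- Let $F := \bigoplus_{i\in[n]} g_i(x_i,y_i)$, where each $g_i$ is one of $x_i\land y_i$, $\neg x_i\land y_i$, $x_i\land\neg y_i$, or $x_i\lor y_i$. Then every monochromatic rectangle of $F$ with respect to the partition $(\{x_1,\dots,x_n\},\{y_1,\dots,y_n\})$ has size at most $2^n$.
   Context: For a partition $(X_1,X_2)$ of the variable set, a combinatorial rectangle is a function $R=R_1(X_1)\land R_2(X_2)$, equivalently a set of assignments $A\times B$ with $A\subseteq\{0,1\}^{X_1}$, $B\subseteq\{0,1\}^{X_2}$; its size is its number of models $|A|\cdot|B|$. $R$ is monochromatic for $F$ if either all models of $R$ are models of $F$ or none is. -}

module Defs where

open import Data.Bool using (Bool; true; false; _∧_; _∨_; not; _xor_)
open import Data.Nat using (ℕ; zero; suc; _*_)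
open import Data.Vec using (Vec; []; _∷_)
open import Data.List using (List; []; _∷_; map; _++_; filter; length)
open import Data.Product using (_×_)
open import Data.Sum using (_⊎_)
open import Relation.Binary.PropositionalEquality using (_≡_)
open import Relation.Nullary.Decidable using (Dec)
open import Data.Bool.Properties using (T?)
open import Data.Bool using (T)

data Gate : Set where
  AND    : Gate
  NXAND  : Gate
  ANDNY  : Gate
  OR     : Gate

evalGate : Gate → Bool → Bool → Bool
evalGate AND   x y = x ∧ y
evalGate NXAND x y = not x ∧ y
evalGate ANDNY x y = x ∧ not y
evalGate OR    x y = x ∨ y

F : ∀ {n} → Vec Gate n → Vec Bool n → Vec Bool n → Bool
F []       []       []       = false
F (g ∷ gs) (x ∷ xs) (y ∷ ys) = evalGate g x y xor F gs xs ys

allAssignments : (n : ℕ) → List (Vec Bool n)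
allAssignments zero    = [] ∷ []
allAssignments (suc n) = map (false ∷_) (allAssignments n) ++ map (true ∷_) (allAssignments n)

countModels : ∀ {n} → (Vec Bool n → Bool) → ℕ
countModels {n} R = length (filter (λ v → T? (R v)) (allAssignments n))

record Rectangle (n : ℕ) : Set where
  field
    R₁ : Vec Bool n → Bool
    R₂ : Vec Bool n → Bool

open Rectangle public

size : ∀ {n} → Rectangle n → ℕ
size R = countModels (R₁ R) * countModels (R₂ R)

Monochromatic : ∀ {n} → (Vec Bool n → Vec Bool n → Bool) → Rectangle n → Set
Monochromatic f R =
    (∀ a b → R₁ R a ≡ true → R₂ R b ≡ true → f a b ≡ true)
  ⊎ (∀ a b → R₁ R a ≡ true → R₂ R b ≡ true → f a b ≡ false)

module Submission where

-- Lindsey's lemma. Let M a b = (-1)^F(a,b). As F is a XOR of gates on disjoint pairs of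
-- variables, M is the Kronecker product of the 2×2 sign matrices of the gates, and each of
-- these has orthogonal rows of squared length 2; hence ‖M v‖² = 2ⁿ ‖v‖². On a monochromatic
-- rectangle A × B the indicator vectors give |1_Aᵀ M 1_B| = |A| |B|, while Cauchy–Schwarz
-- bounds |1_Aᵀ M 1_B|² by ‖1_A‖² ‖M 1_B‖² = 2ⁿ |A| |B|.

open import Defs
open import Data.Nat using (ℕ; _≤_; _^_)
open import Data.Vec using (Vec)

open import Algebra.Definitions using (Interchangable)
import Algebra.Properties.CommutativeSemigroup as CommutativeSemigroupProperties
open import Data.Bool using (Bool; true; false; _xor_)
open import Data.Bool.Properties using (T?)
open import Data.Integer as ℤ using (ℤ; +_; ∣_∣; -_)
import Data.Integer.Properties as ℤ
open import Data.Integer.Tactic.RingSolver as ℤ-Solver using ()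
open import Data.List using (List; []; _∷_; map; _++_; filter; length)
open import Data.List.Properties using (filter-++; length-++)
open import Data.Nat using (zero; suc; _+_; _*_; z≤n; _≤?_)
open import Data.Nat.Properties
open import Data.Nat.Tactic.RingSolver as ℕ-Solver using ()
open import Data.Product using (∃; _,_)
open import Data.Sum using (inj₁; inj₂; [_,_]′)
open import Data.Vec using ([]; _∷_)
open import Function using (_∘_)
open import Relation.Binary.PropositionalEquality
open import Relation.Nullary using (yes; no; contradiction)

cubeSum : {A : Set} → (A → A → A) → {n : ℕ} → (Vec Bool n → A) → A
cubeSum _⊕_ {zero}  f = f []
cubeSum _⊕_ {suc n} f = cubeSum _⊕_ (f ∘ (false ∷_)) ⊕ cubeSum _⊕_ (f ∘ (true ∷_))

module _ {A : Set} {_⊕_ : A → A → A} where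

  cubeSum-cong : ∀ {n} {f g : Vec Bool n → A} → (∀ a → f a ≡ g a) →
                 cubeSum _⊕_ f ≡ cubeSum _⊕_ g
  cubeSum-cong {zero}  f≗g = f≗g []
  cubeSum-cong {suc n} f≗g =
    cong₂ _⊕_ (cubeSum-cong (f≗g ∘ (false ∷_))) (cubeSum-cong (f≗g ∘ (true ∷_)))

  cubeSum-hom : {B : Set} {_⊗_ : B → B → B} (h : A → B) →
                (∀ x y → h (x ⊕ y) ≡ h x ⊗ h y) →
                ∀ {n} (f : Vec Bool n → A) → cubeSum _⊗_ (h ∘ f) ≡ h (cubeSum _⊕_ f)
  cubeSum-hom h h-⊕ {zero}  f = refl
  cubeSum-hom {_⊗_ = _⊗_} h h-⊕ {suc n} f =
    trans (cong₂ _⊗_ (cubeSum-hom h h-⊕ (f ∘ (false ∷_))) (cubeSum-hom h h-⊕ (f ∘ (true ∷_))))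
          (sym (h-⊕ _ _))

  cubeSum-⊕ : Interchangable _≡_ _⊕_ _⊕_ →
              ∀ {n} (f g : Vec Bool n → A) →
              cubeSum _⊕_ (λ a → f a ⊕ g a) ≡ cubeSum _⊕_ f ⊕ cubeSum _⊕_ g
  cubeSum-⊕ interchange {zero}  f g = refl
  cubeSum-⊕ interchange {suc n} f g =
    trans (cong₂ _⊕_ (cubeSum-⊕ interchange (f ∘ (false ∷_)) (g ∘ (false ∷_)))
                     (cubeSum-⊕ interchange (f ∘ (true ∷_)) (g ∘ (true ∷_))))
          (interchange _ _ _ _)

∑ℕ : ∀ {n} → (Vec Bool n → ℕ) → ℕ
∑ℕ = cubeSum _+_

∑ℤ : ∀ {n} → (Vec Bool n → ℤ) → ℤ
∑ℤ = cubeSum ℤ._+_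

∑ℕ-+ : ∀ {n} (f g : Vec Bool n → ℕ) → ∑ℕ (λ a → f a + g a) ≡ ∑ℕ f + ∑ℕ g
∑ℕ-+ = cubeSum-⊕ (CommutativeSemigroupProperties.interchange +-commutativeSemigroup)

∑ℤ-+ : ∀ {n} (f g : Vec Bool n → ℤ) → ∑ℤ (λ a → f a ℤ.+ g a) ≡ ∑ℤ f ℤ.+ ∑ℤ g
∑ℤ-+ = cubeSum-⊕ (CommutativeSemigroupProperties.interchange ℤ.+-commutativeSemigroup)

∑ℤ-pos : ∀ {n} (f : Vec Bool n → ℕ) → ∑ℤ (+_ ∘ f) ≡ + ∑ℕ f
∑ℤ-pos = cubeSum-hom +_ ℤ.pos-+

indicator : Bool → ℕ
indicator false = 0
indicator true  = 1

countModels-∑ : ∀ {n} (R : Vec Bool n → Bool) → countModels R ≡ ∑ℕ (indicator ∘ R)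
countModels-∑ {zero} R with R []
... | true  = refl
... | false = refl
countModels-∑ {suc n} R = begin
  count R (map (false ∷_) all ++ map (true ∷_) all)
    ≡⟨ cong length (filter-++ (T? ∘ R) (map (false ∷_) all) _) ⟩
  length (filter (T? ∘ R) (map (false ∷_) all) ++ filter (T? ∘ R) (map (true ∷_) all))
    ≡⟨ length-++ (filter (T? ∘ R) (map (false ∷_) all)) ⟩
  count R (map (false ∷_) all) + count R (map (true ∷_) all)
    ≡⟨ cong₂ _+_ (count-map (false ∷_) all) (count-map (true ∷_) all) ⟩
  countModels (R ∘ (false ∷_)) + countModels (R ∘ (true ∷_))
    ≡⟨ cong₂ _+_ (countModels-∑ (R ∘ (false ∷_))) (countModels-∑ (R ∘ (true ∷_))) ⟩
  ∑ℕ (indicator ∘ R) ∎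
  where
  open ≡-Reasoning
  all = allAssignments n
  count : ∀ {m} → (Vec Bool m → Bool) → List (Vec Bool m) → ℕ
  count P xs = length (filter (T? ∘ P) xs)
  count-map : (h : Vec Bool n → Vec Bool (suc n)) (xs : List (Vec Bool n)) →
              count R (map h xs) ≡ count (R ∘ h) xs
  count-map h []       = refl
  count-map h (x ∷ xs) with R (h x)
  ... | true  = cong suc (count-map h xs)
  ... | false = count-map h xs

negateIf : Bool → ℤ → ℤ
negateIf false z = z
negateIf true  z = - z

negateIf-xor : ∀ b c z → negateIf (b xor c) z ≡ negateIf c (negateIf b z)
negateIf-xor false c     z = refl
negateIf-xor true  false z = refl
negateIf-xor true  true  z = sym (ℤ.neg-involutive z)

negateIf-+ : ∀ b y z → negateIf b (y ℤ.+ z) ≡ negateIf b y ℤ.+ negateIf b z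
negateIf-+ false y z = refl
negateIf-+ true  y z = ℤ.neg-distrib-+ y z

negateIf-0 : ∀ b → negateIf b (+ 0) ≡ + 0
negateIf-0 false = refl
negateIf-0 true  = refl

*-negateIf : ∀ b y z → y ℤ.* negateIf b z ≡ negateIf b (y ℤ.* z)
*-negateIf false y z = refl
*-negateIf true  y z = sym (ℤ.neg-distribʳ-* y z)

∣negateIf∣ : ∀ b z → ∣ negateIf b z ∣ ≡ ∣ z ∣
∣negateIf∣ false z = refl
∣negateIf∣ true  z = ℤ.∣-i∣≡∣i∣ z

∑ℤ-negateIf : ∀ b {n} (f : Vec Bool n → ℤ) → ∑ℤ (negateIf b ∘ f) ≡ negateIf b (∑ℤ f)
∑ℤ-negateIf b = cubeSum-hom (negateIf b) (negateIf-+ b)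

signMatrix : ∀ {n} → Vec Gate n → (Vec Bool n → ℤ) → Vec Bool n → ℤ
signMatrix gs v a = ∑ℤ (λ b → negateIf (F gs a b) (v b))

gateMix : Gate → Bool → ℤ → ℤ → ℤ
gateMix g x p q = negateIf (evalGate g x false) p ℤ.+ negateIf (evalGate g x true) q

gateRow : ∀ {n} → Gate → Bool → (Vec Bool (suc n) → ℤ) → Vec Bool n → ℤ
gateRow g x v b = gateMix g x (v (false ∷ b)) (v (true ∷ b))

signMatrix-∷ : ∀ {n} g gs (v : Vec Bool (suc n) → ℤ) x a →
               signMatrix (g ∷ gs) v (x ∷ a) ≡ signMatrix gs (gateRow g x v) a
signMatrix-∷ {n} g gs v x a = begin
  ∑ℤ (λ b → negateIf (g₀ xor F gs a b) (v (false ∷ b)))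
    ℤ.+ ∑ℤ (λ b → negateIf (g₁ xor F gs a b) (v (true ∷ b)))
    ≡⟨ ∑ℤ-+ {n} _ _ ⟨
  ∑ℤ (λ b → negateIf (g₀ xor F gs a b) (v (false ∷ b))
            ℤ.+ negateIf (g₁ xor F gs a b) (v (true ∷ b)))
    ≡⟨ cubeSum-cong (λ b → factor (F gs a b) (v (false ∷ b)) (v (true ∷ b))) ⟩
  signMatrix gs (gateRow g x v) a ∎
  where
  open ≡-Reasoning
  g₀ = evalGate g x false
  g₁ = evalGate g x true
  factor : ∀ s p q → negateIf (g₀ xor s) p ℤ.+ negateIf (g₁ xor s) q ≡ negateIf s (gateMix g x p q)
  factor s p q = trans (cong₂ ℤ._+_ (negateIf-xor g₀ s p) (negateIf-xor g₁ s q))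
                       (sym (negateIf-+ s _ _))

sq : ℤ → ℕ
sq z = ∣ z ∣ * ∣ z ∣

pos-sq : ∀ z → + sq z ≡ z ℤ.* z
pos-sq (+ n)      = sym (ℤ.+◃n≡+n _)
pos-sq ℤ.-[1+ n ] = sym (ℤ.+◃n≡+n _)

normSq : ∀ {n} → (Vec Bool n → ℤ) → ℕ
normSq v = ∑ℕ (sq ∘ v)

-- Each gate has an odd number of true entries in its truth table, which is exactly what
-- makes the two rows of its sign matrix orthogonal.
gateMix-orthogonal : ∀ g p q →
  gateMix g false p q ℤ.* gateMix g false p q ℤ.+ gateMix g true p q ℤ.* gateMix g true p q
    ≡ (p ℤ.* p ℤ.+ q ℤ.* q) ℤ.+ (p ℤ.* p ℤ.+ q ℤ.* q)
gateMix-orthogonal AND = identity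
  where
  identity : ∀ p q → (p ℤ.+ q) ℤ.* (p ℤ.+ q) ℤ.+ (p ℤ.+ - q) ℤ.* (p ℤ.+ - q)
                     ≡ (p ℤ.* p ℤ.+ q ℤ.* q) ℤ.+ (p ℤ.* p ℤ.+ q ℤ.* q)
  identity = ℤ-Solver.solve-∀
gateMix-orthogonal NXAND = identity
  where
  identity : ∀ p q → (p ℤ.+ - q) ℤ.* (p ℤ.+ - q) ℤ.+ (p ℤ.+ q) ℤ.* (p ℤ.+ q)
                     ≡ (p ℤ.* p ℤ.+ q ℤ.* q) ℤ.+ (p ℤ.* p ℤ.+ q ℤ.* q)
  identity = ℤ-Solver.solve-∀
gateMix-orthogonal ANDNY = identity
  where
  identity : ∀ p q → (p ℤ.+ q) ℤ.* (p ℤ.+ q) ℤ.+ (- p ℤ.+ q) ℤ.* (- p ℤ.+ q)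
                     ≡ (p ℤ.* p ℤ.+ q ℤ.* q) ℤ.+ (p ℤ.* p ℤ.+ q ℤ.* q)
  identity = ℤ-Solver.solve-∀
gateMix-orthogonal OR = identity
  where
  identity : ∀ p q → (p ℤ.+ - q) ℤ.* (p ℤ.+ - q) ℤ.+ (- p ℤ.+ - q) ℤ.* (- p ℤ.+ - q)
                     ≡ (p ℤ.* p ℤ.+ q ℤ.* q) ℤ.+ (p ℤ.* p ℤ.+ q ℤ.* q)
  identity = ℤ-Solver.solve-∀

sq-gateMix : ∀ g p q →
  sq (gateMix g false p q) + sq (gateMix g true p q) ≡ (sq p + sq q) + (sq p + sq q)
sq-gateMix g p q = ℤ.+-injective (begin
  + (sq r₀ + sq r₁)                       ≡⟨ ℤ.pos-+ (sq r₀) (sq r₁) ⟩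
  + sq r₀ ℤ.+ + sq r₁                     ≡⟨ cong₂ ℤ._+_ (pos-sq r₀) (pos-sq r₁) ⟩
  r₀ ℤ.* r₀ ℤ.+ r₁ ℤ.* r₁                 ≡⟨ gateMix-orthogonal g p q ⟩
  (p ℤ.* p ℤ.+ q ℤ.* q) ℤ.+ (p ℤ.* p ℤ.+ q ℤ.* q) ≡⟨ cong₂ ℤ._+_ pq pq ⟨
  + (sq p + sq q) ℤ.+ + (sq p + sq q)     ≡⟨ ℤ.pos-+ (sq p + sq q) (sq p + sq q) ⟨
  + ((sq p + sq q) + (sq p + sq q))       ∎)
  where
  open ≡-Reasoning
  r₀ = gateMix g false p q
  r₁ = gateMix g true p q
  pq : + (sq p + sq q) ≡ p ℤ.* p ℤ.+ q ℤ.* q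
  pq = trans (ℤ.pos-+ (sq p) (sq q)) (cong₂ ℤ._+_ (pos-sq p) (pos-sq q))

normSq-gateRows : ∀ {n} g (v : Vec Bool (suc n) → ℤ) →
                  normSq (gateRow g false v) + normSq (gateRow g true v) ≡ normSq v + normSq v
normSq-gateRows {n} g v = begin
  normSq (gateRow g false v) + normSq (gateRow g true v)
    ≡⟨ ∑ℕ-+ {n} _ _ ⟨
  ∑ℕ (λ b → sq (gateRow g false v b) + sq (gateRow g true v b))
    ≡⟨ cubeSum-cong (λ b → sq-gateMix g (v (false ∷ b)) (v (true ∷ b))) ⟩
  ∑ℕ (λ b → (sq (v (false ∷ b)) + sq (v (true ∷ b))) + (sq (v (false ∷ b)) + sq (v (true ∷ b))))
    ≡⟨ ∑ℕ-+ {n} _ _ ⟩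
  ∑ℕ (λ b → sq (v (false ∷ b)) + sq (v (true ∷ b)))
    + ∑ℕ (λ b → sq (v (false ∷ b)) + sq (v (true ∷ b)))
    ≡⟨ cong₂ _+_ (∑ℕ-+ {n} _ _) (∑ℕ-+ {n} _ _) ⟩
  normSq v + normSq v ∎
  where open ≡-Reasoning

normSq-signMatrix : ∀ {n} (gs : Vec Gate n) (v : Vec Bool n → ℤ) →
                    normSq (signMatrix gs v) ≡ 2 ^ n * normSq v
normSq-signMatrix []       v = sym (+-identityʳ (sq (v [])))
normSq-signMatrix {suc n} (g ∷ gs) v = begin
  normSq (signMatrix (g ∷ gs) v)
    ≡⟨ cong₂ _+_ (cubeSum-cong (λ a → cong sq (signMatrix-∷ g gs v false a)))
                 (cubeSum-cong (λ a → cong sq (signMatrix-∷ g gs v true a))) ⟩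
  normSq (signMatrix gs (gateRow g false v)) + normSq (signMatrix gs (gateRow g true v))
    ≡⟨ cong₂ _+_ (normSq-signMatrix gs (gateRow g false v))
                 (normSq-signMatrix gs (gateRow g true v)) ⟩
  2 ^ n * normSq (gateRow g false v) + 2 ^ n * normSq (gateRow g true v)
    ≡⟨ *-distribˡ-+ (2 ^ n) _ _ ⟨
  2 ^ n * (normSq (gateRow g false v) + normSq (gateRow g true v))
    ≡⟨ cong (2 ^ n *_) (normSq-gateRows g v) ⟩
  2 ^ n * (normSq v + normSq v)
    ≡⟨ doubling (2 ^ n) (normSq v) ⟩
  2 ^ suc n * normSq v ∎
  where
  open ≡-Reasoning
  doubling : ∀ m k → m * (k + k) ≡ (2 * m) * k
  doubling = ℕ-Solver.solve-∀

square-≤⇒≤ : ∀ m n → m * m ≤ n * n → m ≤ n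
square-≤⇒≤ m n m²≤n² with m ≤? n
... | yes m≤n = m≤n
... | no  m≰n = contradiction m²≤n² (<⇒≱ (*-mono-< (≰⇒> m≰n) (≰⇒> m≰n)))

four-*-≤-square-+ : ∀ s t → 4 * (s * t) ≤ (s + t) * (s + t)
four-*-≤-square-+ s t = [ ordered , flipped ]′ (≤-total s t)
  where
  ordered : ∀ {s t} → s ≤ t → 4 * (s * t) ≤ (s + t) * (s + t)
  ordered {s} s≤t with d , refl ← m≤n⇒∃[o]m+o≡n s≤t =
    ≤-trans (m≤m+n _ (d * d)) (≤-reflexive (identity s d))
    where
    identity : ∀ s d → 4 * (s * (s + d)) + d * d ≡ (s + (s + d)) * (s + (s + d))
    identity = ℕ-Solver.solve-∀
  flipped : t ≤ s → 4 * (s * t) ≤ (s + t) * (s + t)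
  flipped t≤s = subst₂ _≤_ (cong (4 *_) (*-comm t s)) (cong (λ m → m * m) (+-comm t s))
                           (ordered t≤s)

cauchySchwarz-+ : ∀ x y a b p q → x * x ≤ a * p → y * y ≤ b * q →
                  (x + y) * (x + y) ≤ (a + b) * (p + q)
cauchySchwarz-+ x y a b p q x²≤ap y²≤bq = begin
  (x + y) * (x + y)                   ≡⟨ square-+ x y ⟩
  (x * x + y * y) + 2 * (x * y)       ≤⟨ +-mono-≤ (+-mono-≤ x²≤ap y²≤bq) cross ⟩
  (a * p + b * q) + (a * q + b * p)   ≡⟨ product-+ a b p q ⟩
  (a + b) * (p + q)                   ∎
  where
  open ≤-Reasoning
  square-+ : ∀ x y → (x + y) * (x + y) ≡ (x * x + y * y) + 2 * (x * y)
  square-+ = ℕ-Solver.solve-∀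
  product-+ : ∀ a b p q → (a * p + b * q) + (a * q + b * p) ≡ (a + b) * (p + q)
  product-+ = ℕ-Solver.solve-∀
  square-double : ∀ x y → (2 * (x * y)) * (2 * (x * y)) ≡ 4 * ((x * x) * (y * y))
  square-double = ℕ-Solver.solve-∀
  swap-factors : ∀ a b p q → (a * p) * (b * q) ≡ (a * q) * (b * p)
  swap-factors = ℕ-Solver.solve-∀
  cross : 2 * (x * y) ≤ a * q + b * p
  cross = square-≤⇒≤ _ _ (begin
    (2 * (x * y)) * (2 * (x * y))  ≡⟨ square-double x y ⟩
    4 * ((x * x) * (y * y))        ≤⟨ *-monoʳ-≤ 4 (*-mono-≤ x²≤ap y²≤bq) ⟩
    4 * ((a * p) * (b * q))        ≡⟨ cong (4 *_) (swap-factors a b p q) ⟩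
    4 * ((a * q) * (b * p))        ≤⟨ four-*-≤-square-+ (a * q) (b * p) ⟩
    (a * q + b * p) * (a * q + b * p) ∎)

sq-* : ∀ y z → sq (y ℤ.* z) ≡ sq y * sq z
sq-* y z = begin
  ∣ y ℤ.* z ∣ * ∣ y ℤ.* z ∣             ≡⟨ cong (λ m → m * m) (ℤ.abs-* y z) ⟩
  (∣ y ∣ * ∣ z ∣) * (∣ y ∣ * ∣ z ∣)     ≡⟨ interchange ∣ y ∣ ∣ z ∣ ⟩
  (∣ y ∣ * ∣ y ∣) * (∣ z ∣ * ∣ z ∣)     ∎
  where
  open ≡-Reasoning
  interchange : ∀ m n → (m * n) * (m * n) ≡ (m * m) * (n * n)
  interchange = ℕ-Solver.solve-∀

cauchySchwarz : ∀ {n} (u v : Vec Bool n → ℤ) →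
                sq (∑ℤ (λ a → u a ℤ.* v a)) ≤ normSq u * normSq v
cauchySchwarz {zero}  u v = ≤-reflexive (sq-* (u []) (v []))
cauchySchwarz {suc n} u v = begin
  sq (s₀ ℤ.+ s₁)                ≤⟨ *-mono-≤ triangle triangle ⟩
  (∣ s₀ ∣ + ∣ s₁ ∣) * (∣ s₀ ∣ + ∣ s₁ ∣)
    ≤⟨ cauchySchwarz-+ ∣ s₀ ∣ ∣ s₁ ∣ (normSq u₀) (normSq u₁) (normSq v₀) (normSq v₁)
                       (cauchySchwarz u₀ v₀) (cauchySchwarz u₁ v₁) ⟩
  normSq u * normSq v           ∎
  where
  open ≤-Reasoning
  u₀ = u ∘ (false ∷_)
  u₁ = u ∘ (true ∷_)
  v₀ = v ∘ (false ∷_)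
  v₁ = v ∘ (true ∷_)
  s₀ = ∑ℤ (λ a → u₀ a ℤ.* v₀ a)
  s₁ = ∑ℤ (λ a → u₁ a ℤ.* v₁ a)
  triangle : ∣ s₀ ℤ.+ s₁ ∣ ≤ ∣ s₀ ∣ + ∣ s₁ ∣
  triangle = ℤ.∣i+j∣≤∣i∣+∣j∣ s₀ s₁

𝟙 : Bool → ℤ
𝟙 b = + indicator b

normSq-𝟙 : ∀ {n} (R : Vec Bool n → Bool) → normSq (𝟙 ∘ R) ≡ countModels R
normSq-𝟙 R = trans (cubeSum-cong (sq-𝟙 ∘ R)) (sym (countModels-∑ R))
  where
  sq-𝟙 : ∀ b → sq (𝟙 b) ≡ indicator b
  sq-𝟙 false = refl
  sq-𝟙 true  = refl

∑ℤ-𝟙 : ∀ {n} (R : Vec Bool n → Bool) → ∑ℤ (𝟙 ∘ R) ≡ + countModels R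
∑ℤ-𝟙 R = trans (∑ℤ-pos (indicator ∘ R)) (cong +_ (sym (countModels-∑ R)))

module _ {n} (gs : Vec Gate n) (A B : Vec Bool n → Bool) (c : Bool)
         (coloured : ∀ a b → A a ≡ true → B b ≡ true → F gs a b ≡ c) where

  signMatrix-rectangleRow : ∀ a → A a ≡ true →
                            signMatrix gs (𝟙 ∘ B) a ≡ negateIf c (+ countModels B)
  signMatrix-rectangleRow a Aa = begin
    ∑ℤ (λ b → negateIf (F gs a b) (𝟙 (B b))) ≡⟨ cubeSum-cong entry ⟩
    ∑ℤ (negateIf c ∘ 𝟙 ∘ B)                ≡⟨ ∑ℤ-negateIf c (𝟙 ∘ B) ⟩
    negateIf c (∑ℤ (𝟙 ∘ B))                ≡⟨ cong (negateIf c) (∑ℤ-𝟙 B) ⟩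
    negateIf c (+ countModels B)           ∎
    where
    open ≡-Reasoning
    entry : ∀ b → negateIf (F gs a b) (𝟙 (B b)) ≡ negateIf c (𝟙 (B b))
    entry b with B b in Bb
    ... | true  = cong (λ s → negateIf s (+ 1)) (coloured a b Aa Bb)
    ... | false = trans (negateIf-0 (F gs a b)) (sym (negateIf-0 c))

  correlation-rectangle : ∑ℤ (λ a → 𝟙 (A a) ℤ.* signMatrix gs (𝟙 ∘ B) a)
                          ≡ negateIf c (+ (countModels A * countModels B))
  correlation-rectangle = begin
    ∑ℤ (λ a → 𝟙 (A a) ℤ.* signMatrix gs (𝟙 ∘ B) a) ≡⟨ cubeSum-cong restrict ⟩
    ∑ℤ (λ a → 𝟙 (A a) ℤ.* row)
      ≡⟨ cubeSum-hom (ℤ._* row) (λ x y → ℤ.*-distribʳ-+ row x y) (𝟙 ∘ A) ⟩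
    ∑ℤ (𝟙 ∘ A) ℤ.* row                              ≡⟨ cong (ℤ._* row) (∑ℤ-𝟙 A) ⟩
    + countModels A ℤ.* row                         ≡⟨ *-negateIf c (+ countModels A) (+ countModels B) ⟩
    negateIf c (+ countModels A ℤ.* + countModels B)
      ≡⟨ cong (negateIf c) (ℤ.pos-* (countModels A) (countModels B)) ⟨
    negateIf c (+ (countModels A * countModels B))   ∎
    where
    open ≡-Reasoning
    row = negateIf c (+ countModels B)
    restrict : ∀ a → 𝟙 (A a) ℤ.* signMatrix gs (𝟙 ∘ B) a ≡ 𝟙 (A a) ℤ.* row
    restrict a with A a in Aa
    ... | true  = cong (+ 1 ℤ.*_) (signMatrix-rectangleRow a Aa)
    ... | false = refl

monochromatic-colour : ∀ {n} {f : Vec Bool n → Vec Bool n → Bool} {R : Rectangle n} →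
  Monochromatic f R → ∃ λ c → ∀ a b → R₁ R a ≡ true → R₂ R b ≡ true → f a b ≡ c
monochromatic-colour (inj₁ coloured) = true , coloured
monochromatic-colour (inj₂ coloured) = false , coloured

square-≤-*⇒≤ : ∀ m k → m * m ≤ m * k → m ≤ k
square-≤-*⇒≤ zero    k _     = z≤n
square-≤-*⇒≤ (suc m) k m²≤mk = *-cancelˡ-≤ (suc m) m²≤mk

proposition6 : (n : ℕ) (g : Vec Gate n) (R : Rectangle n) →
    Monochromatic (F g) R → size R ≤ 2 ^ n
proposition6 n g R mono with c , coloured ← monochromatic-colour mono =
  square-≤-*⇒≤ (size R) (2 ^ n) (begin
    size R * size R                         ≡⟨ cong (λ m → m * m) (∣negateIf∣ c (+ size R)) ⟨
    sq (negateIf c (+ size R))              ≡⟨ cong sq (correlation-rectangle g A B c coloured) ⟨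
    sq (∑ℤ (λ a → u a ℤ.* signMatrix g v a)) ≤⟨ cauchySchwarz u (signMatrix g v) ⟩
    normSq u * normSq (signMatrix g v)      ≡⟨ cong (normSq u *_) (normSq-signMatrix g v) ⟩
    normSq u * (2 ^ n * normSq v)           ≡⟨ cong₂ (λ a b → a * (2 ^ n * b)) (normSq-𝟙 A) (normSq-𝟙 B) ⟩
    countModels A * (2 ^ n * countModels B) ≡⟨ x∙yz≈xz∙y (countModels A) (2 ^ n) (countModels B) ⟩
    size R * 2 ^ n                          ∎)
  where
  open ≤-Reasoning
  open CommutativeSemigroupProperties *-commutativeSemigroup using (x∙yz≈xz∙y)
  A = R₁ R
  B = R₂ R
  u = 𝟙 ∘ A
  v = 𝟙 ∘ B
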